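{- Let $n\ge1$, $i\in[n]$, $N\in[2^n]$ and $p=2^i$. Then the set $\{\mathcal{S}(c_{i,n},j,N):j\in[2^n]\}$ has exactly $1+\min\big(N\bmod p,\ p-(N\bmod p)\big)$ elements.
   Context: For $m\ge0$ and $i\ge1$, $\mathrm{bin}(m,i)$ is the $i$-th bit of $m$ counted from the least significant bit. For $i\in[n]$, $c_{i,n}$ is the $0$-$1$ list of length $2^n$ with $c_{i,n}(j)=\mathrm{bin}(j-1,i)$. For a list $L$ of length $M$, $j\in[M]$ and $N\ge1$, $\mathcal{S}(L,j,N)=\sum_{t=0}^{N-1}L\big(1+((j+t-1)\bmod M)\big)$ is the cyclic contiguous sum of $N$ entries starting at index $j$. -}

module Defs where

open import Data.Nat using (ℕ; zero; suc; _+_; _∸_; _^_; NonZero)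
open import Data.Nat.DivMod using (_/_; _%_)
open import Data.Nat.Properties using (_≟_)
open import Data.List using (List; []; _∷_; map; upTo; length; deduplicate)
open import Data.Nat.ListAction using (sum)

2^-nonZero : ∀ k → NonZero (2 ^ k)
2^-nonZero zero = _
2^-nonZero (suc k) with 2 ^ k | 2^-nonZero k
... | suc m | _ = _

-- bin m i : the i-th bit of m counted from the least significant bit (i ≥ 1)
-- bin m i = ⌊ m / 2^(i-1) ⌋ mod 2
bin : ℕ → ℕ → ℕ
bin m i = ((_/_ m (2 ^ (i ∸ 1)) {{2^-nonZero (i ∸ 1)}}) % 2)

-- 1-indexed list access: at L k = L(k) for 1 ≤ k ≤ length L (default 0 elsewhere)
at : List ℕ → ℕ → ℕ
at [] k = 0
at (x ∷ xs) zero = 0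
at (x ∷ xs) (suc zero) = x
at (x ∷ xs) (suc (suc k)) = at xs (suc k)

-- c i n : list of length 2^n with c(j) = bin(j-1, i) for j ∈ [2^n]
c : ℕ → ℕ → List ℕ
c i n = map (λ m → bin m i) (upTo (2 ^ n))

S : (L : List ℕ) → {{NonZero (length L)}} → ℕ → ℕ → ℕ
S L j N = sum (map (λ t → at L (suc ((j + t ∸ 1) % length L))) (upTo N))

card : List ℕ → ℕ
card xs = length (deduplicate _≟_ xs)

open import Data.List.Properties using (length-map; length-upTo)
open import Relation.Binary.PropositionalEquality using (_≡_; subst; sym; trans)

c-nonZero : ∀ i n → NonZero (length (c i n))
c-nonZero i n = subst NonZero (sym (trans (length-map (λ m → bin m i) (upTo (2 ^ n))) (length-upTo (2 ^ n)))) (2^-nonZero n)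

-- The list c_{i,n} is a square wave of period p = 2^i (p/2 zeros, then p/2 ones), and p divides
-- its length 2^n, so the cyclic sums are sliding-window sums of the wave.  A window of length
-- N = q p + r (r < p) sums to q p/2 plus the sum of a window of length r, and the latter lies
-- between r - p/2 and min(r, p/2), since the complementary window of length p - r sums to
-- p/2 minus it.  Every value w in that range is attained by the window ending at p/2 + w, which
-- consists of zeros followed by exactly w ones; so there are 1 + min(r, p - r) values.
module Submission where

open import Defs
open import Data.Nat
open import Data.Nat.Properties
open import Data.Nat.DivMod
open import Data.Nat.Divisibility using (divides-refl)
open import Data.Nat.ListAction using (sum)
open import Data.Product using (∃; _,_; _×_)
open import Data.List using (List; map; upTo; applyUpTo; length; deduplicate)
open import Data.List.Properties using (length-map; length-upTo; length-applyUpTo; map-upTo)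
open import Data.List.Membership.Propositional using (_∈_)
open import Data.List.Membership.Propositional.Properties
  using (∈-map⁺; ∈-map⁻; ∈-upTo⁺; ∈-applyUpTo⁺; ∈-applyUpTo⁻; deduplicate-∈⇔)
open import Data.List.Membership.Propositional.Properties.WithK using (unique∧set⇒bag)
open import Data.List.Relation.Unary.Unique.Propositional using (Unique)
open import Data.List.Relation.Unary.Unique.Propositional.Properties using (applyUpTo⁺₁)
open import Data.List.Relation.Unary.Unique.DecPropositional.Properties _≟_ using (deduplicate-!)
open import Data.List.Relation.Binary.BagAndSetEquality using (∼bag⇒↭)
open import Data.List.Relation.Binary.Permutation.Propositional.Properties using (↭-length)
open import Function using (_∘_)
open import Function.Bundles using (_⇔_; mk⇔; Equivalence)
open import Relation.Binary.PropositionalEquality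
open import Relation.Nullary using (Dec; yes; no)

card-of-interval : ∀ (xs : List ℕ) a k →
  (∀ {y} → y ∈ xs → a ≤ y × y ≤ a + k) → (∀ d → d ≤ k → a + d ∈ xs) →
  card xs ≡ suc k
card-of-interval xs a k bounded covers =
  trans (↭-length (∼bag⇒↭ (unique∧set⇒bag (deduplicate-! xs) interval-unique same-elements)))
        (length-applyUpTo (a +_) (suc k))
  where
  interval : List ℕ
  interval = applyUpTo (a +_) (suc k)

  interval-unique : Unique interval
  interval-unique = applyUpTo⁺₁ (a +_) (suc k) (λ i<j _ → <⇒≢ i<j ∘ +-cancelˡ-≡ a _ _)

  to : ∀ {x} → x ∈ deduplicate _≟_ xs → x ∈ interval
  to x∈ with bounded (Equivalence.from (deduplicate-∈⇔ _≟_) x∈)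
  ... | a≤x , x≤a+k = subst (_∈ interval) (m+[n∸m]≡n a≤x)
                        (∈-applyUpTo⁺ (a +_) (s≤s (m≤n+o⇒m∸n≤o _ a x≤a+k)))

  from : ∀ {x} → x ∈ interval → x ∈ deduplicate _≟_ xs
  from x∈ with ∈-applyUpTo⁻ (a +_) x∈
  ... | d , d<1+k , refl = Equivalence.to (deduplicate-∈⇔ _≟_) (covers d (s≤s⁻¹ d<1+k))

  same-elements : ∀ {x} → (x ∈ deduplicate _≟_ xs) ⇔ (x ∈ interval)
  same-elements = mk⇔ to from

window : (ℕ → ℕ) → ℕ → ℕ → ℕ
window f y zero    = 0
window f y (suc N) = f y + window f (suc y) N

module _ (f : ℕ → ℕ) where

  window-+ : ∀ y m N → window f y m + window f (y + m) N ≡ window f y (m + N)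
  window-+ y zero    N = cong (λ z → window f z N) (+-identityʳ y)
  window-+ y (suc m) N = begin
    f y + window f (suc y) m + window f (y + suc m) N  ≡⟨ cong (λ z → f y + window f (suc y) m + window f z N) (+-suc y m) ⟩
    f y + window f (suc y) m + window f (suc y + m) N  ≡⟨ +-assoc (f y) _ _ ⟩
    f y + (window f (suc y) m + window f (suc y + m) N) ≡⟨ cong (f y +_) (window-+ (suc y) m N) ⟩
    f y + window f (suc y) (m + N)                      ∎
    where open ≡-Reasoning

  window-snoc : ∀ y N → window f y (suc N) ≡ window f y N + f (y + N)
  window-snoc y N = begin
    window f y (suc N)                ≡⟨ cong (window f y) (+-comm 1 N) ⟩
    window f y (N + 1)                ≡⟨ window-+ y N 1 ⟨
    window f y N + (f (y + N) + 0)    ≡⟨ cong (window f y N +_) (+-identityʳ _) ⟩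
    window f y N + f (y + N)          ∎
    where open ≡-Reasoning

  window-≤-length : (∀ t → f t ≤ 1) → ∀ y N → window f y N ≤ N
  window-≤-length f≤1 y zero    = z≤n
  window-≤-length f≤1 y (suc N) = +-mono-≤ (f≤1 y) (window-≤-length f≤1 (suc y) N)

  sum-applyUpTo≡window : ∀ g y N → (∀ t → t < N → g t ≡ f (y + t)) →
    sum (applyUpTo g N) ≡ window f y N
  sum-applyUpTo≡window g y zero    _   = refl
  sum-applyUpTo≡window g y (suc N) g≗ = cong₂ _+_
    (trans (g≗ 0 z<s) (cong f (+-identityʳ y)))
    (sum-applyUpTo≡window (g ∘ suc) (suc y) N
      (λ t t<N → trans (g≗ (suc t) (s<s t<N)) (cong f (+-suc y t))))

at-applyUpTo : ∀ (g : ℕ → ℕ) M z → z < M → at (applyUpTo g M) (suc z) ≡ g z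
at-applyUpTo g (suc M) zero    _   = refl
at-applyUpTo g (suc M) (suc z) z<M = at-applyUpTo (g ∘ suc) M z (s<s⁻¹ z<M)

2*m≡m+m : ∀ m → 2 * m ≡ m + m
2*m≡m+m m = cong (m +_) (+-identityʳ m)

2*m∸m≡m : ∀ m → 2 * m ∸ m ≡ m
2*m∸m≡m m = trans (cong (_∸ m) (2*m≡m+m m)) (m+n∸m≡n m m)

m+n∸o≤m : ∀ m {n o} → n ≤ o → m + n ∸ o ≤ m
m+n∸o≤m m {n} {o} n≤o = subst (m + n ∸ o ≤_) (m+n∸n≡m m n) (∸-monoʳ-≤ (m + n) n≤o)

⊓-half≡∸-half+spread : ∀ h r → r ≤ 2 * h → r ⊓ h ≡ (r ∸ h) + r ⊓ (2 * h ∸ r)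
⊓-half≡∸-half+spread h r r≤2h with r ≤? h
... | yes r≤h = begin
    r ⊓ h                      ≡⟨ m≤n⇒m⊓n≡m r≤h ⟩
    r                          ≡⟨ m≤n⇒m⊓n≡m r≤2h∸r ⟨
    r ⊓ (2 * h ∸ r)            ≡⟨ cong (_+ r ⊓ (2 * h ∸ r)) (m≤n⇒m∸n≡0 r≤h) ⟨
    (r ∸ h) + r ⊓ (2 * h ∸ r)  ∎
  where
  open ≡-Reasoning
  r≤2h∸r : r ≤ 2 * h ∸ r
  r≤2h∸r = ≤-trans r≤h (subst (_≤ 2 * h ∸ r) (2*m∸m≡m h) (∸-monoʳ-≤ (2 * h) r≤h))
... | no r≰h = begin
    r ⊓ h                            ≡⟨ m≥n⇒m⊓n≡n h≤r ⟩
    h                                ≡⟨ m+[n∸m]≡n r∸h≤h ⟨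
    (r ∸ h) + (h ∸ (r ∸ h))          ≡⟨ cong (λ z → (r ∸ h) + (z ∸ (r ∸ h))) (2*m∸m≡m h) ⟨
    (r ∸ h) + (2 * h ∸ h ∸ (r ∸ h))  ≡⟨ cong ((r ∸ h) +_) (∸-+-assoc (2 * h) h (r ∸ h)) ⟩
    (r ∸ h) + (2 * h ∸ (h + (r ∸ h))) ≡⟨ cong (λ z → (r ∸ h) + (2 * h ∸ z)) (m+[n∸m]≡n h≤r) ⟩
    (r ∸ h) + (2 * h ∸ r)            ≡⟨ cong ((r ∸ h) +_) (m≥n⇒m⊓n≡n 2h∸r≤r) ⟨
    (r ∸ h) + r ⊓ (2 * h ∸ r)        ∎
  where
  open ≡-Reasoning
  h≤r : h ≤ r
  h≤r = ≰⇒≥ r≰h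
  r∸h≤h : r ∸ h ≤ h
  r∸h≤h = m≤n+o⇒m∸n≤o r h (subst (r ≤_) (2*m≡m+m h) r≤2h)
  2h∸r≤r : 2 * h ∸ r ≤ r
  2h∸r≤r = ≤-trans (subst (2 * h ∸ r ≤_) (2*m∸m≡m h) (∸-monoʳ-≤ (2 * h) h≤r)) h≤r

module _ (k : ℕ) where
  private instance
    2^k≢0 : NonZero (2 ^ k)
    2^k≢0 = 2^-nonZero k

  bin-low : ∀ {t} → t < 2 ^ k → bin t (suc k) ≡ 0
  bin-low t<2^k = cong (_% 2) (m<n⇒m/n≡0 t<2^k)

  bin-high : ∀ {t} → 2 ^ k ≤ t → t < 2 * 2 ^ k → bin t (suc k) ≡ 1
  bin-high {t} 2^k≤t t<2^k+1 = cong (_% 2) (begin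
    t / 2 ^ k              ≡⟨ m/n≡1+[m∸n]/n 2^k≤t ⟩
    1 + (t ∸ 2 ^ k) / 2 ^ k ≡⟨ cong suc (m<n⇒m/n≡0 (m<n+o⇒m∸n<o t (2 ^ k) t<2^k+2^k)) ⟩
    1                      ∎)
    where
    open ≡-Reasoning
    t<2^k+2^k : t < 2 ^ k + 2 ^ k
    t<2^k+2^k = subst (t <_) (2*m≡m+m (2 ^ k)) t<2^k+1

  bin-periodic : ∀ t a → bin (t + a * (2 * 2 ^ k)) (suc k) ≡ bin t (suc k)
  bin-periodic t a = begin
    (t + a * (2 * 2 ^ k)) / 2 ^ k % 2  ≡⟨ cong (λ z → (t + z) / 2 ^ k % 2) (*-assoc a 2 (2 ^ k)) ⟨
    (t + a * 2 * 2 ^ k) / 2 ^ k % 2    ≡⟨ cong (_% 2) (+-distrib-/-∣ʳ t (divides-refl (a * 2))) ⟩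
    (t / 2 ^ k + a * 2 * 2 ^ k / 2 ^ k) % 2 ≡⟨ cong (λ z → (t / 2 ^ k + z) % 2) (m*n/n≡m (a * 2) (2 ^ k)) ⟩
    (t / 2 ^ k + a * 2) % 2            ≡⟨ [m+kn]%n≡m%n (t / 2 ^ k) a 2 ⟩
    t / 2 ^ k % 2                      ∎
    where open ≡-Reasoning

  bin-%-2^ : ∀ {n} → suc k ≤ n → ∀ t → bin ((t % 2 ^ n) {{2^-nonZero n}}) (suc k) ≡ bin t (suc k)
  bin-%-2^ {n} k<n t = begin
    bin (t % 2 ^ n) (suc k)                              ≡⟨ bin-periodic (t % 2 ^ n) (t / 2 ^ n * 2 ^ (n ∸ suc k)) ⟨
    bin (t % 2 ^ n + t / 2 ^ n * 2 ^ (n ∸ suc k) * 2 ^ suc k) (suc k)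
      ≡⟨ cong (λ z → bin (t % 2 ^ n + z) (suc k)) (*-assoc (t / 2 ^ n) _ _) ⟩
    bin (t % 2 ^ n + t / 2 ^ n * (2 ^ (n ∸ suc k) * 2 ^ suc k)) (suc k)
      ≡⟨ cong (λ z → bin (t % 2 ^ n + t / 2 ^ n * z) (suc k)) 2^n≡2^[n-k-1]*2^[k+1] ⟨
    bin (t % 2 ^ n + t / 2 ^ n * 2 ^ n) (suc k)          ≡⟨ cong (λ z → bin z (suc k)) (m≡m%n+[m/n]*n t (2 ^ n)) ⟨
    bin t (suc k)                                        ∎
    where
    open ≡-Reasoning
    instance
      2^n≢0 : NonZero (2 ^ n)
      2^n≢0 = 2^-nonZero n
    2^n≡2^[n-k-1]*2^[k+1] : 2 ^ n ≡ 2 ^ (n ∸ suc k) * 2 ^ suc k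
    2^n≡2^[n-k-1]*2^[k+1] = trans (cong (2 ^_) (sym (m∸n+n≡m k<n))) (^-distribˡ-+-* 2 (n ∸ suc k) (suc k))

module SquareWave (h : ℕ) .{{_ : NonZero h}} (f : ℕ → ℕ)
  (f-low : ∀ {t} → t < h → f t ≡ 0)
  (f-high : ∀ {t} → h ≤ t → t < 2 * h → f t ≡ 1)
  (f-periodic : ∀ t a → f (t + a * (2 * h)) ≡ f t) where

  private instance
    2h≢0 : NonZero (2 * h)
    2h≢0 = m*n≢0 2 h

  f-shift : ∀ t → f (t + 2 * h) ≡ f t
  f-shift t = trans (cong (λ z → f (t + z)) (sym (*-identityˡ (2 * h)))) (f-periodic t 1)

  f≤1 : ∀ t → f t ≤ 1
  f≤1 t = subst (_≤ 1) f[t%2h]≡f[t] (within-period (t % (2 * h)) (m%n<n t (2 * h)))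
    where
    f[t%2h]≡f[t] : f (t % (2 * h)) ≡ f t
    f[t%2h]≡f[t] = trans (sym (f-periodic _ (t / (2 * h)))) (cong f (sym (m≡m%n+[m/n]*n t (2 * h))))
    within-period : ∀ s → s < 2 * h → f s ≤ 1
    within-period s s<2h with s <? h
    ... | yes s<h = subst (_≤ 1) (sym (f-low s<h)) z≤n
    ... | no s≮h = ≤-reflexive (f-high (≮⇒≥ s≮h) s<2h)

  W : ℕ → ℕ → ℕ
  W = window f

  window-from-0 : ∀ s → s ≤ 2 * h → W 0 s ≡ s ∸ h
  window-from-0 zero    _      = sym (0∸n≡0 h)
  window-from-0 (suc s) s<2h = begin
    W 0 (suc s)      ≡⟨ window-snoc f 0 s ⟩
    W 0 s + f s      ≡⟨ cong (_+ f s) (window-from-0 s (<⇒≤ s<2h)) ⟩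
    (s ∸ h) + f s    ≡⟨ next-bit (s <? h) ⟩
    suc s ∸ h        ∎
    where
    open ≡-Reasoning
    next-bit : Dec (s < h) → (s ∸ h) + f s ≡ suc s ∸ h
    next-bit (yes s<h) = trans (cong₂ _+_ (m≤n⇒m∸n≡0 (<⇒≤ s<h)) (f-low s<h)) (sym (m≤n⇒m∸n≡0 s<h))
    next-bit (no s≮h)  = trans (cong ((s ∸ h) +_) (f-high (≮⇒≥ s≮h) s<2h))
                               (trans (sym (+-∸-comm 1 (≮⇒≥ s≮h))) (cong (_∸ h) (+-comm s 1)))

  window-period : ∀ x → W x (2 * h) ≡ h
  window-period zero    = trans (window-from-0 (2 * h) ≤-refl) (2*m∸m≡m h)
  window-period (suc x) = trans (+-cancelˡ-≡ (f x) _ _ slide) (window-period x)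
    where
    open ≡-Reasoning
    slide : f x + W (suc x) (2 * h) ≡ f x + W x (2 * h)
    slide = begin
      W x (suc (2 * h))          ≡⟨ window-snoc f x (2 * h) ⟩
      W x (2 * h) + f (x + 2 * h) ≡⟨ cong (W x (2 * h) +_) (f-shift x) ⟩
      W x (2 * h) + f x          ≡⟨ +-comm _ (f x) ⟩
      f x + W x (2 * h)          ∎

  window-multiple : ∀ x q → W x (q * (2 * h)) ≡ q * h
  window-multiple x zero    = refl
  window-multiple x (suc q) = trans (sym (window-+ f x (2 * h) (q * (2 * h))))
                                    (cong₂ _+_ (window-period x) (window-multiple (x + 2 * h) q))

  window-periods : ∀ x r q → W x (r + q * (2 * h)) ≡ W x r + q * h
  window-periods x r q = trans (sym (window-+ f x r _)) (cong (W x r +_) (window-multiple (x + r) q))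

  module _ {r : ℕ} (r≤2h : r ≤ 2 * h) where

    window-complement : ∀ x → W x r + W (x + r) (2 * h ∸ r) ≡ h
    window-complement x = trans (window-+ f x r _) (trans (cong (W x) (m+[n∸m]≡n r≤2h)) (window-period x))

    window-≤-half : ∀ x → W x r ≤ h
    window-≤-half x = subst (W x r ≤_) (window-complement x) (m≤m+n _ _)

    window-≥-∸-half : ∀ x → r ∸ h ≤ W x r
    window-≥-∸-half x = m≤n+o⇒m∸n≤o r h (+-cancelʳ-≤ w′ r (h + w) r+w′≤h+w+w′)
      where
      open ≤-Reasoning
      w w′ : ℕ
      w = W x r
      w′ = W (x + r) (2 * h ∸ r)
      r+w′≤h+w+w′ : r + w′ ≤ h + w + w′
      r+w′≤h+w+w′ = begin
        r + w′           ≤⟨ +-monoʳ-≤ r (window-≤-length f f≤1 (x + r) (2 * h ∸ r)) ⟩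
        r + (2 * h ∸ r)  ≡⟨ m+[n∸m]≡n r≤2h ⟩
        2 * h            ≡⟨ 2*m≡m+m h ⟩
        h + h            ≡⟨ cong (h +_) (window-complement x) ⟨
        h + (w + w′)     ≡⟨ +-assoc h w w′ ⟨
        h + w + w′       ∎

    window-attains : ∀ {w} → r ∸ h ≤ w → w ≤ r ⊓ h → W (h + w ∸ r) r ≡ w
    window-attains {w} r∸h≤w w≤r⊓h = begin
      W x r          ≡⟨ cong (_+ W x r) W0x≡0 ⟨
      W 0 x + W x r  ≡⟨ window-+ f 0 x r ⟩
      W 0 (x + r)    ≡⟨ cong (W 0) (m∸n+n≡m r≤h+w) ⟩
      W 0 (h + w)    ≡⟨ window-from-0 (h + w) h+w≤2h ⟩
      h + w ∸ h      ≡⟨ m+n∸m≡n h w ⟩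
      w              ∎
      where
      open ≡-Reasoning
      x : ℕ
      x = h + w ∸ r
      r≤h+w : r ≤ h + w
      r≤h+w = ≤-trans (m≤n+m∸n r h) (+-monoʳ-≤ h r∸h≤w)
      h+w≤2h : h + w ≤ 2 * h
      h+w≤2h = subst (h + w ≤_) (sym (2*m≡m+m h)) (+-monoʳ-≤ h (≤-trans w≤r⊓h (m⊓n≤n r h)))
      x≤h : x ≤ h
      x≤h = m+n∸o≤m h (≤-trans w≤r⊓h (m⊓n≤m r h))
      W0x≡0 : W 0 x ≡ 0
      W0x≡0 = trans (window-from-0 x (≤-trans x≤h (m≤n*m h 2))) (m≤n⇒m∸n≡0 x≤h)

  min-window : ℕ → ℕ
  min-window N = N / (2 * h) * h + (N % (2 * h) ∸ h)

  window-spread : ℕ → ℕ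
  window-spread N = N % (2 * h) ⊓ (2 * h ∸ N % (2 * h))

  module _ (N : ℕ) where
    private
      r q : ℕ
      r = N % (2 * h)
      q = N / (2 * h)
      r≤2h : r ≤ 2 * h
      r≤2h = <⇒≤ (m%n<n N (2 * h))

    window-by-residue : ∀ x → W x N ≡ q * h + W x r
    window-by-residue x = begin
      W x N                  ≡⟨ cong (W x) (m≡m%n+[m/n]*n N (2 * h)) ⟩
      W x (r + q * (2 * h))  ≡⟨ window-periods x r q ⟩
      W x r + q * h          ≡⟨ +-comm _ (q * h) ⟩
      q * h + W x r          ∎
      where open ≡-Reasoning

    window-bounds : ∀ x → min-window N ≤ W x N × W x N ≤ min-window N + window-spread N
    window-bounds x =
      subst (min-window N ≤_) (sym (window-by-residue x)) (+-monoʳ-≤ (q * h) (window-≥-∸-half r≤2h x)) ,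
      (begin
        W x N                                   ≡⟨ window-by-residue x ⟩
        q * h + W x r                           ≤⟨ +-monoʳ-≤ (q * h) (⊓-glb (window-≤-length f f≤1 x r) (window-≤-half r≤2h x)) ⟩
        q * h + r ⊓ h                           ≡⟨ cong (q * h +_) (⊓-half≡∸-half+spread h r r≤2h) ⟩
        q * h + ((r ∸ h) + window-spread N)     ≡⟨ +-assoc (q * h) _ _ ⟨
        min-window N + window-spread N          ∎)
      where open ≤-Reasoning

    window-covers : ∀ d → d ≤ window-spread N → ∃ λ x → x ≤ h × W x N ≡ min-window N + d
    window-covers d d≤spread = x , m+n∸o≤m h (≤-trans w≤r⊓h (m⊓n≤m r h)) , (begin
        W x N                ≡⟨ window-by-residue x ⟩
        q * h + W x r        ≡⟨ cong (q * h +_) (window-attains r≤2h (m≤m+n _ d) w≤r⊓h) ⟩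
        q * h + w            ≡⟨ +-assoc (q * h) _ d ⟨
        min-window N + d     ∎)
      where
      open ≡-Reasoning
      w x : ℕ
      w = (r ∸ h) + d
      x = h + w ∸ r
      w≤r⊓h : w ≤ r ⊓ h
      w≤r⊓h = subst (w ≤_) (sym (⊓-half≡∸-half+spread h r r≤2h)) (+-monoʳ-≤ (r ∸ h) d≤spread)

length-c : ∀ i n → length (c i n) ≡ 2 ^ n
length-c i n = trans (length-map (λ m → bin m i) (upTo (2 ^ n))) (length-upTo (2 ^ n))

S-c≡window : ∀ {k n} → suc k ≤ n → ∀ x N →
  S (c (suc k) n) {{c-nonZero (suc k) n}} (suc x) N ≡ window (λ m → bin m (suc k)) x N
S-c≡window {k} {n} k<n x N =
  trans (cong sum (map-upTo entry N)) (sum-applyUpTo≡window bit entry x N (λ t _ → entry≡bit t))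
  where
  instance
    2^n≢0 : NonZero (2 ^ n)
    2^n≢0 = 2^-nonZero n
    length≢0 : NonZero (length (c (suc k) n))
    length≢0 = c-nonZero (suc k) n
  bit : ℕ → ℕ
  bit m = bin m (suc k)
  entry : ℕ → ℕ
  entry t = at (c (suc k) n) (suc ((x + t) % length (c (suc k) n)))
  entry≡bit : ∀ t → entry t ≡ bit (x + t)
  entry≡bit t = begin
    entry t                                            ≡⟨ cong (λ z → at (c (suc k) n) (suc z)) (%-congʳ (length-c (suc k) n)) ⟩
    at (c (suc k) n) (suc ((x + t) % 2 ^ n))           ≡⟨ cong (λ l → at l (suc ((x + t) % 2 ^ n))) (map-upTo bit (2 ^ n)) ⟩
    at (applyUpTo bit (2 ^ n)) (suc ((x + t) % 2 ^ n)) ≡⟨ at-applyUpTo bit (2 ^ n) _ (m%n<n (x + t) (2 ^ n)) ⟩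
    bit ((x + t) % 2 ^ n)                              ≡⟨ bin-%-2^ k k<n (x + t) ⟩
    bit (x + t)                                        ∎
    where open ≡-Reasoning

corollary19 : (n i N : ℕ) → 1 ≤ n → 1 ≤ i → i ≤ n → 1 ≤ N → N ≤ 2 ^ n →
    card (map (λ j → S (c i n) {{c-nonZero i n}} j N) (map suc (upTo (2 ^ n))))
      ≡ 1 + ((N % 2 ^ i) {{2^-nonZero i}} ⊓ (2 ^ i ∸ (N % 2 ^ i) {{2^-nonZero i}}))
corollary19 n (suc k) N _ _ k<n _ _ =
  card-of-interval sums (min-window N) (window-spread N) bounded covered
  where
  open SquareWave (2 ^ k) {{2^-nonZero k}} (λ m → bin m (suc k)) (bin-low k) (bin-high k) (bin-periodic k)

  sums : List ℕ
  sums = map (λ j → S (c (suc k) n) {{c-nonZero (suc k) n}} j N) (map suc (upTo (2 ^ n)))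

  bounded : ∀ {y} → y ∈ sums → min-window N ≤ y × y ≤ min-window N + window-spread N
  bounded y∈ with _ , j∈ , refl ← ∈-map⁻ _ y∈ with x , _ , refl ← ∈-map⁻ suc j∈ =
    subst (λ y → min-window N ≤ y × y ≤ min-window N + window-spread N)
          (sym (S-c≡window k<n x N)) (window-bounds N x)

  covered : ∀ d → d ≤ window-spread N → min-window N + d ∈ sums
  covered d d≤spread with x , x≤2^k , W≡ ← window-covers N d d≤spread =
    subst (_∈ sums) (trans (S-c≡window k<n x N) W≡) (∈-map⁺ _ (∈-map⁺ suc (∈-upTo⁺ x<2^n)))
    where
    x<2^n : x < 2 ^ n
    x<2^n = ≤-<-trans x≤2^k (^-monoʳ-< 2 ≤-refl k<n)
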